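{- Let $q$ be a prime, $n>1$ an integer dividing $q-1$, and $k$ an integer of multiplicative order $n$ modulo $q$. For an integer $t$ let $[t]$ denote the unique integer with $0\le[t]\le q-1$ and $[t]\equiv t \pmod q$. For $1\le l\le q-1$ put $S_l = l+[kl]+\cdots+[k^{n-1}l]$. Then $S_l$ is a multiple of $q$, and: (i) if $n$ is even, then $S_l = \frac{n}{2}q$; (ii) if $n=3$, then $S_l\in\{q,2q\}$, and $S_l=q$ for exactly $\frac{q-1}{2}$ values of $l\in\{1,\dots,q-1\}$; (iii) if $n>3$ is odd, then there exists $l$ with $S_l>q$ and $S_{q-l}>q$. -}

module Defs where

open import Data.Nat using (ℕ; zero; suc; _+_; _*_; _<_; NonZero)
open import Data.Integer as ℤ using (ℤ; +_)
open import Data.Integer.DivMod using (_%ℕ_)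
open import Data.List using (List; map; upTo)
open import Data.Nat.ListAction using (sum)
open import Data.Product using (_×_)
open import Relation.Nullary using (¬_)
open import Relation.Binary.PropositionalEquality using (_≡_)

_^ℤ_ : ℤ → ℕ → ℤ
k ^ℤ zero  = + 1
k ^ℤ suc m = k ℤ.* (k ^ℤ m)

red : (q : ℕ) .{{_ : NonZero q}} → ℤ → ℕ
red q t = t %ℕ q

MultOrder : (q : ℕ) .{{_ : NonZero q}} → ℤ → ℕ → Set
MultOrder q k n =
  (0 < n) ×
  (red q (k ^ℤ n) ≡ red q (+ 1)) ×
  (∀ m → 0 < m → m < n → ¬ (red q (k ^ℤ m) ≡ red q (+ 1)))

-- S_l = l + [k l] + ⋯ + [k^{n-1} l] = Σ_{i=0}^{n-1} [k^i l]
-- (for 1 ≤ l ≤ q-1 the i = 0 term [l] equals l)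
S : (q : ℕ) .{{_ : NonZero q}} → ℤ → ℕ → ℕ → ℕ
S q k n l = sum (map (λ i → red q ((k ^ℤ i) ℤ.* (+ l))) (upTo n))

-- Write [k^i l] for the residues summed in S_l. Multiplication by k permutes them cyclically
-- (k^n ≡ 1), so k S_l ≡ S_l; as k ≢ 1 and q is prime, q ∣ S_l. Since q ∤ k^i l, we have
-- [k^i l] + [k^i (q − l)] = q, whence S_l + S_{q−l} = n q; when n = 2m the same pairing happens
-- inside S_l, because k^m ≡ −1. For n = 3, S_l and S_{q−l} are positive multiples of q summing
-- to 3q, hence q and 2q in some order, so l ↦ q − l exchanges the l with S_l = q and the others.
-- For (iii), l ↦ S_l is subadditive and q-periodic, hence so is l ↦ S_{q−l} on 1 … q − 1. If no
-- l had S_l, S_{q−l} > q, then for every l one of them would be ≤ q and the other ≥ n q − q > 2q.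
-- Starting from whichever of S_1, S_{q−1} is ≤ q, subadditivity (a step from ≤ q lands ≤ 2q)
-- keeps that function ≤ q up to q − 1, giving n q = S_1 + S_{q−1} ≤ 2q.

module Submission where

open import Defs
open import Data.Nat.Base as ℕ using (ℕ; zero; suc; NonZero; z≤n; s≤s)
import Data.Nat.Properties as ℕ
import Data.Nat.Divisibility as ℕ
open import Data.Nat.DivMod using (m%n≤m)
open import Data.Nat.Primality using (Prime; euclidsLemma; prime⇒nonTrivial)
open import Data.Sum using (_⊎_; inj₁; inj₂; [_,_]′; fromInj₂)
import Data.Sum as Sum
open import Relation.Nullary using (¬_; contradiction; contradiction₂)
open import Relation.Binary.PropositionalEquality
open import Function.Base using (_∘′_)
open import Level using (0ℓ)
open import Relation.Binary.Bundles using (Setoid)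
import Relation.Binary.Reasoning.Setoid as SetoidReasoning

multiple<⇒≡0 : ∀ {m n} → m ℕ.∣ n → n ℕ.< m → n ≡ 0
multiple<⇒≡0 {n = zero}  _   _   = refl
multiple<⇒≡0 {n = suc _} m∣n n<m = contradiction m∣n (ℕ.>⇒∤ n<m)

positive-multiple<q+q⇒≡q : ∀ {q s} → q ℕ.∣ s → 0 ℕ.< s → s ℕ.< q ℕ.+ q → s ≡ q
positive-multiple<q+q⇒≡q     (ℕ.divides-refl 0)             ()
positive-multiple<q+q⇒≡q {q} (ℕ.divides-refl 1)             _ _    = ℕ.+-identityʳ q
positive-multiple<q+q⇒≡q {q} (ℕ.divides-refl (suc (suc c))) _ s<2q =
  contradiction s<2q (ℕ.≤⇒≯ (ℕ.+-monoʳ-≤ q (ℕ.m≤m+n q (c ℕ.* q))))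

module IntegerCongruence where

  open import Data.Integer.Base using (ℤ; +_; _+_; _-_; -_; _*_; ∣_∣; 0ℤ)
  import Data.Integer.Properties as ℤ
  open import Data.Integer.DivMod using (_/ℕ_; a≡a%ℕn+[a/ℕn]*n; n%ℕd<d)
  open import Data.Integer.Divisibility.Signed
    using (_∣_; divides; ∣m⇒∣-m; ∣m∣n⇒∣m+n; ∣n⇒∣m*n; ∣m⇒∣m*n; ∣⇒∣ᵤ; ∣ᵤ⇒∣)
  open import Data.Integer.Tactic.RingSolver using (solve-∀)

  -- A record rather than a synonym for + q ∣ x - y, so that x and y can be inferred.
  infix 4 _≡_[mod_]
  record _≡_[mod_] (x y : ℤ) (q : ℕ) : Set where
    constructor ∣⇒≡-mod
    field ≡-mod⇒∣ : + q ∣ x - y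
  open _≡_[mod_] public

  module _ {q : ℕ} where

    ≡-mod-via : ∀ {x y z} → x - y ≡ z → + q ∣ z → x ≡ y [mod q ]
    ≡-mod-via eq = ∣⇒≡-mod ∘′ subst (+ q ∣_) (sym eq)

    ≡⇒≡-mod : ∀ {x y} → x ≡ y → x ≡ y [mod q ]
    ≡⇒≡-mod {x} refl = ∣⇒≡-mod (divides 0ℤ (ℤ.+-inverseʳ x))

    ≡-mod-sym : ∀ {x y} → x ≡ y [mod q ] → y ≡ x [mod q ]
    ≡-mod-sym {x} {y} = ≡-mod-via (identity x y) ∘′ ∣m⇒∣-m ∘′ ≡-mod⇒∣
      where
      identity : ∀ x y → y - x ≡ - (x - y)
      identity = solve-∀

    ≡-mod-trans : ∀ {x y z} → x ≡ y [mod q ] → y ≡ z [mod q ] → x ≡ z [mod q ]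
    ≡-mod-trans {x} {y} {z} x≡y y≡z =
      ≡-mod-via (identity x y z) (∣m∣n⇒∣m+n (≡-mod⇒∣ x≡y) (≡-mod⇒∣ y≡z))
      where
      identity : ∀ x y z → x - z ≡ (x - y) + (y - z)
      identity = solve-∀

    +-cong-≡-mod : ∀ {x x′ y y′} → x ≡ x′ [mod q ] → y ≡ y′ [mod q ] → x + y ≡ x′ + y′ [mod q ]
    +-cong-≡-mod {x} {x′} {y} {y′} x≡x′ y≡y′ =
      ≡-mod-via (identity x x′ y y′) (∣m∣n⇒∣m+n (≡-mod⇒∣ x≡x′) (≡-mod⇒∣ y≡y′))
      where
      identity : ∀ x x′ y y′ → (x + y) - (x′ + y′) ≡ (x - x′) + (y - y′)
      identity = solve-∀

    *-congˡ-≡-mod : ∀ z {x y} → x ≡ y [mod q ] → z * x ≡ z * y [mod q ]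
    *-congˡ-≡-mod z {x} {y} = ≡-mod-via (identity z x y) ∘′ ∣n⇒∣m*n z ∘′ ≡-mod⇒∣
      where
      identity : ∀ z x y → z * x - z * y ≡ z * (x - y)
      identity = solve-∀

    *-congʳ-≡-mod : ∀ z {x y} → x ≡ y [mod q ] → x * z ≡ y * z [mod q ]
    *-congʳ-≡-mod z {x} {y} = ≡-mod-via (identity z x y) ∘′ ∣m⇒∣m*n z ∘′ ≡-mod⇒∣
      where
      identity : ∀ z x y → x * z - y * z ≡ (x - y) * z
      identity = solve-∀

    multiple-≡0-mod : ∀ t → t * + q ≡ + 0 [mod q ]
    multiple-≡0-mod t = ∣⇒≡-mod (divides t (ℤ.+-identityʳ (t * + q)))

    +-multiple-≡-mod : ∀ x t → x + t * + q ≡ x [mod q ]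
    +-multiple-≡-mod x t = ∣⇒≡-mod (divides t (identity x (t * + q)))
      where
      identity : ∀ x y → x + y - x ≡ y
      identity = solve-∀

    ≡-mod⇒-≡0-mod : ∀ {x y} → x ≡ y [mod q ] → x - y ≡ + 0 [mod q ]
    ≡-mod⇒-≡0-mod {x} {y} = ∣⇒≡-mod ∘′ subst (+ q ∣_) (sym (ℤ.+-identityʳ (x - y))) ∘′ ≡-mod⇒∣

    -≡0-mod⇒≡-mod : ∀ {x y} → x - y ≡ + 0 [mod q ] → x ≡ y [mod q ]
    -≡0-mod⇒≡-mod {x} {y} = ∣⇒≡-mod ∘′ subst (+ q ∣_) (ℤ.+-identityʳ (x - y)) ∘′ ≡-mod⇒∣

    pos-≡0-mod⇒∣ : ∀ {a} → + a ≡ + 0 [mod q ] → q ℕ.∣ a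
    pos-≡0-mod⇒∣ {a} = ∣⇒∣ᵤ ∘′ subst (+ q ∣_) (ℤ.+-identityʳ (+ a)) ∘′ ≡-mod⇒∣

    ≡0-mod-^ : ∀ {x} i → x ≡ + 0 [mod q ] → x ^ℤ suc i ≡ + 0 [mod q ]
    ≡0-mod-^ i = *-congʳ-≡-mod (_ ^ℤ i)

  module _ (q : ℕ) .{{_ : NonZero q}} where

    red-≡-mod : ∀ x → + red q x ≡ x [mod q ]
    red-≡-mod x = ∣⇒≡-mod (divides (- (x /ℕ q)) (begin
      + red q x - x                             ≡⟨ cong (λ y → + red q x - y) (a≡a%ℕn+[a/ℕn]*n x q) ⟩
      + red q x - (+ red q x + (x /ℕ q) * + q)  ≡⟨ identity (+ red q x) (x /ℕ q) (+ q) ⟩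
      - (x /ℕ q) * + q                          ∎))
      where
      open ≡-Reasoning
      identity : ∀ r t q → r - (r + t * q) ≡ - t * q
      identity = solve-∀

    private
      residue-≤ : ∀ {a b} → a ℕ.≤ b → b ℕ.< q → + b ≡ + a [mod q ] → b ℕ.≤ a
      residue-≤ {a} {b} a≤b b<q b≡a =
        ℕ.m∸n≡0⇒m≤n (multiple<⇒≡0 q∣b∸a (ℕ.≤-<-trans (ℕ.m∸n≤m b a) b<q))
        where
        q∣b∸a : q ℕ.∣ b ℕ.∸ a
        q∣b∸a = ∣⇒∣ᵤ (subst (+ q ∣_) (trans (ℤ.[+m]-[+n]≡m⊖n b a) (ℤ.⊖-≥ a≤b)) (≡-mod⇒∣ b≡a))

    residue-unique : ∀ {a b} → a ℕ.< q → b ℕ.< q → + a ≡ + b [mod q ] → a ≡ b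
    residue-unique {a} {b} a<q b<q a≡b with ℕ.≤-total a b
    ... | inj₁ a≤b = ℕ.≤-antisym a≤b (residue-≤ a≤b b<q (≡-mod-sym a≡b))
    ... | inj₂ b≤a = ℕ.≤-antisym (residue-≤ b≤a a<q a≡b) b≤a

    red-cong : ∀ {x y} → x ≡ y [mod q ] → red q x ≡ red q y
    red-cong {x} {y} x≡y = residue-unique (n%ℕd<d x q) (n%ℕd<d y q)
      (≡-mod-trans (red-≡-mod x) (≡-mod-trans x≡y (≡-mod-sym (red-≡-mod y))))

    red-injective : ∀ {x y} → red q x ≡ red q y → x ≡ y [mod q ]
    red-injective {x} {y} eq =
      ≡-mod-trans (≡-mod-sym (red-≡-mod x)) (≡-mod-trans (≡⇒≡-mod (cong +_ eq)) (red-≡-mod y))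

    red≡0⇒≡0-mod : ∀ {x} → red q x ≡ 0 → x ≡ + 0 [mod q ]
    red≡0⇒≡0-mod {x} eq = ≡-mod-trans (≡-mod-sym (red-≡-mod x)) (≡⇒≡-mod (cong +_ eq))

    red-+-≤ : ∀ x y → red q (x + y) ℕ.≤ red q x ℕ.+ red q y
    red-+-≤ x y = begin
      red q (x + y)                       ≡⟨ red-cong (+-cong-≡-mod (≡-mod-sym (red-≡-mod x)) (≡-mod-sym (red-≡-mod y))) ⟩
      red q (+ red q x + + red q y)       ≡⟨ cong (red q) (ℤ.pos-+ (red q x) (red q y)) ⟨
      (red q x ℕ.+ red q y) ℕ.% q         ≤⟨ m%n≤m _ q ⟩
      red q x ℕ.+ red q y                 ∎
      where open ℕ.≤-Reasoning

    red-+-complement : ∀ {x y} → x + y ≡ + 0 [mod q ] → ¬ (x ≡ + 0 [mod q ]) → red q x ℕ.+ red q y ≡ q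
    red-+-complement {x} {y} x+y≡0 x≢0 = positive-multiple<q+q⇒≡q q∣s 0<s (ℕ.+-mono-< (n%ℕd<d x q) (n%ℕd<d y q))
      where
      s≡x+y : + (red q x ℕ.+ red q y) ≡ x + y [mod q ]
      s≡x+y = ≡-mod-trans (≡⇒≡-mod (ℤ.pos-+ (red q x) (red q y))) (+-cong-≡-mod (red-≡-mod x) (red-≡-mod y))
      q∣s : q ℕ.∣ red q x ℕ.+ red q y
      q∣s = pos-≡0-mod⇒∣ (≡-mod-trans s≡x+y x+y≡0)
      0<s : 0 ℕ.< red q x ℕ.+ red q y
      0<s = ℕ.<-≤-trans (ℕ.n≢0⇒n>0 (x≢0 ∘′ red≡0⇒≡0-mod)) (ℕ.m≤m+n _ _)

  ≡-mod-setoid : ℕ → Setoid 0ℓ 0ℓ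
  ≡-mod-setoid q = record
    { Carrier       = ℤ
    ; _≈_           = _≡_[mod q ]
    ; isEquivalence = record { refl = ≡⇒≡-mod refl ; sym = ≡-mod-sym ; trans = ≡-mod-trans }
    }

  module ≡-mod-Reasoning {q : ℕ} = SetoidReasoning (≡-mod-setoid q)

  ^ℤ-+ : ∀ x a b → x ^ℤ (a ℕ.+ b) ≡ x ^ℤ a * x ^ℤ b
  ^ℤ-+ x zero    b = sym (ℤ.*-identityˡ (x ^ℤ b))
  ^ℤ-+ x (suc a) b = trans (cong (x *_) (^ℤ-+ x a b)) (sym (ℤ.*-assoc x (x ^ℤ a) (x ^ℤ b)))

  module _ {q : ℕ} (q-prime : Prime q) where

    prime-≡0-mod-* : ∀ {x y} → x * y ≡ + 0 [mod q ] → x ≡ + 0 [mod q ] ⊎ y ≡ + 0 [mod q ]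
    prime-≡0-mod-* {x} {y} xy≡0 =
      Sum.map ∣ᵤ⇒≡0-mod ∣ᵤ⇒≡0-mod (euclidsLemma ∣ x ∣ ∣ y ∣ q-prime (subst (q ℕ.∣_) ∣xy∣≡∣x∣∣y∣ (∣⇒∣ᵤ (≡-mod⇒∣ xy≡0))))
      where
      ∣xy∣≡∣x∣∣y∣ : ∣ x * y - + 0 ∣ ≡ ∣ x ∣ ℕ.* ∣ y ∣
      ∣xy∣≡∣x∣∣y∣ = trans (cong ∣_∣ (ℤ.+-identityʳ (x * y))) (ℤ.abs-* x y)
      ∣ᵤ⇒≡0-mod : ∀ {z} → q ℕ.∣ ∣ z ∣ → z ≡ + 0 [mod q ]
      ∣ᵤ⇒≡0-mod {z} q∣z = ∣⇒≡-mod (subst (+ q ∣_) (sym (ℤ.+-identityʳ z)) (∣ᵤ⇒∣ q∣z))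

    prime-1≢0-mod : ¬ (+ 1 ≡ + 0 [mod q ])
    prime-1≢0-mod 1≡0 = ℕ.nonTrivial⇒≢1 {{prime⇒nonTrivial q-prime}} (ℕ.∣1⇒≡1 (∣⇒∣ᵤ (≡-mod⇒∣ 1≡0)))

    prime-^-≢0-mod : ∀ {x} i → ¬ (x ≡ + 0 [mod q ]) → ¬ (x ^ℤ i ≡ + 0 [mod q ])
    prime-^-≢0-mod zero    _   = prime-1≢0-mod
    prime-^-≢0-mod (suc i) x≢0 = [ x≢0 , prime-^-≢0-mod i x≢0 ]′ ∘′ prime-≡0-mod-*

    *-fixed⇒≡0-mod : ∀ {x y} → x * y ≡ y [mod q ] → ¬ (x ≡ + 1 [mod q ]) → y ≡ + 0 [mod q ]
    *-fixed⇒≡0-mod {x} {y} xy≡y x≢1 = fromInj₂ (λ x-1≡0 → contradiction (-≡0-mod⇒≡-mod x-1≡0) x≢1)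
      (prime-≡0-mod-* (≡-mod-trans (≡⇒≡-mod (identity x y)) (≡-mod⇒-≡0-mod xy≡y)))
      where
      identity : ∀ x y → (x - + 1) * y ≡ x * y - y
      identity = solve-∀

    prime-square-root-of-1 : ∀ {x} → x * x ≡ + 1 [mod q ] → ¬ (x ≡ + 1 [mod q ]) → x + + 1 ≡ + 0 [mod q ]
    prime-square-root-of-1 {x} x²≡1 = *-fixed⇒≡0-mod (begin
      x * (x + + 1)   ≡⟨ ℤ.*-distribˡ-+ x x (+ 1) ⟩
      x * x + x * + 1 ≈⟨ +-cong-≡-mod x²≡1 (≡⇒≡-mod (ℤ.*-identityʳ x)) ⟩
      + 1 + x         ≡⟨ ℤ.+-comm (+ 1) x ⟩
      x + + 1         ∎)
      where open ≡-mod-Reasoning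

open IntegerCongruence
open import Data.Nat.Base using (_+_; _*_; _∸_; _/_; _≤_; _<_; _>_)
open import Data.Nat.Properties using (_≟_)
open import Data.Nat.Divisibility using (_∣_)
open import Data.List.Base using (length; filter; map; upTo; applyUpTo)
open import Data.List.Properties using (map-upTo)
open import Data.Nat.ListAction using (sum)
open import Relation.Nullary using (Dec; yes; no)
open import Relation.Nullary.Decidable using (_×-dec_)
open import Data.Product using (_×_; _,_; proj₁; proj₂; ∃-syntax)
open import Relation.Unary using (Pred; Decidable)
open import Function.Bundles using (_⇔_; Equivalence; mk⇔)
open import Data.Nat.DivMod using (m*n/n≡m)
open import Algebra.Properties.CommutativeSemigroup ℕ.+-commutativeSemigroup
  using () renaming (interchange to +-interchange)

sumUpTo : (ℕ → ℕ) → ℕ → ℕ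
sumUpTo f n = sum (applyUpTo f n)

sumUpTo-cong : ∀ {f g} n → (∀ i → i < n → f i ≡ g i) → sumUpTo f n ≡ sumUpTo g n
sumUpTo-cong zero    _   = refl
sumUpTo-cong (suc n) f≗g = cong₂ _+_ (f≗g 0 (s≤s z≤n)) (sumUpTo-cong n (λ i i<n → f≗g (suc i) (s≤s i<n)))

sumUpTo-mono-≤ : ∀ {f g} n → (∀ i → f i ≤ g i) → sumUpTo f n ≤ sumUpTo g n
sumUpTo-mono-≤ zero    _   = z≤n
sumUpTo-mono-≤ (suc n) f≤g = ℕ.+-mono-≤ (f≤g 0) (sumUpTo-mono-≤ n (λ i → f≤g (suc i)))

sumUpTo-+ : ∀ f g n → sumUpTo (λ i → f i + g i) n ≡ sumUpTo f n + sumUpTo g n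
sumUpTo-+ f g zero    = refl
sumUpTo-+ f g (suc n) = trans (cong (f 0 + g 0 +_) (sumUpTo-+ (f ∘′ suc) (g ∘′ suc) n))
                              (+-interchange (f 0) (g 0) _ _)

sumUpTo-const : ∀ c n → sumUpTo (λ _ → c) n ≡ n * c
sumUpTo-const c zero    = refl
sumUpTo-const c (suc n) = cong (c +_) (sumUpTo-const c n)

sumUpTo-suc : ∀ f n → sumUpTo f (suc n) ≡ sumUpTo f n + f n
sumUpTo-suc f zero    = ℕ.+-comm (f 0) 0
sumUpTo-suc f (suc n) = trans (cong (f 0 +_) (sumUpTo-suc (f ∘′ suc) n))
                              (sym (ℕ.+-assoc (f 0) _ (f (suc n))))

sumUpTo-+-split : ∀ f m n → sumUpTo f (m + n) ≡ sumUpTo f m + sumUpTo (λ i → f (m + i)) n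
sumUpTo-+-split f zero    n = refl
sumUpTo-+-split f (suc m) n = trans (cong (f 0 +_) (sumUpTo-+-split (f ∘′ suc) m n))
                                    (sym (ℕ.+-assoc (f 0) _ _))

sumUpTo-reverse : ∀ f n → sumUpTo f n ≡ sumUpTo (λ i → f (n ∸ suc i)) n
sumUpTo-reverse f zero    = refl
sumUpTo-reverse f (suc n) = begin
  sumUpTo f (suc n)                          ≡⟨ sumUpTo-suc f n ⟩
  sumUpTo f n + f n                          ≡⟨ ℕ.+-comm _ (f n) ⟩
  f n + sumUpTo f n                          ≡⟨ cong (f n +_) (sumUpTo-reverse f n) ⟩
  f n + sumUpTo (λ i → f (n ∸ suc i)) n      ∎
  where open ≡-Reasoning

sumUpTo-rotate : ∀ f n → f n ≡ f 0 → sumUpTo (f ∘′ suc) n ≡ sumUpTo f n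
sumUpTo-rotate f n fn≡f0 = ℕ.+-cancelˡ-≡ (f 0) _ _ (begin
  f 0 + sumUpTo (f ∘′ suc) n    ≡⟨ sumUpTo-suc f n ⟩
  sumUpTo f n + f n             ≡⟨ cong (sumUpTo f n +_) fn≡f0 ⟩
  sumUpTo f n + f 0             ≡⟨ ℕ.+-comm _ (f 0) ⟩
  f 0 + sumUpTo f n             ∎)
  where open ≡-Reasoning

indicator : ∀ {p} {P : Set p} → Dec P → ℕ
indicator (yes _) = 1
indicator (no _)  = 0

length-filter-applyUpTo : ∀ {p} {P : Pred ℕ p} (P? : Decidable P) g n →
  length (filter P? (applyUpTo g n)) ≡ sumUpTo (λ i → indicator (P? (g i))) n
length-filter-applyUpTo P? g zero    = refl
length-filter-applyUpTo P? g (suc n) with P? (g 0)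
... | yes _ = cong suc (length-filter-applyUpTo P? (g ∘′ suc) n)
... | no  _ = length-filter-applyUpTo P? (g ∘′ suc) n

count-swapped-by-involution : ∀ {p} {P : Pred ℕ p} (P? : Decidable P) N →
  (∀ l → 1 ≤ l → l ≤ N → P (suc N ∸ l) ⇔ (¬ P l)) →
  length (filter P? (map suc (upTo N))) ≡ N / 2
count-swapped-by-involution P? N swap = begin
  length (filter P? (map suc (upTo N)))  ≡⟨ cong (length ∘′ filter P?) (map-upTo suc N) ⟩
  length (filter P? (applyUpTo suc N))   ≡⟨ length-filter-applyUpTo P? suc N ⟩
  c                                      ≡⟨ m*n/n≡m c 2 ⟨
  c * 2 / 2                              ≡⟨ cong (_/ 2) (trans (ℕ.*-comm c 2) 2c≡N) ⟩
  N / 2                                  ∎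
  where
  open ≡-Reasoning
  χ : ℕ → ℕ
  χ l = indicator (P? l)

  c : ℕ
  c = sumUpTo (χ ∘′ suc) N

  complementary : ∀ i → i < N → χ (N ∸ i) + χ (suc i) ≡ 1
  complementary i i<N with P? (N ∸ i) | P? (suc i) | swap (suc i) (s≤s z≤n) i<N
  ... | yes P[N-i] | yes P[1+i] | P⇔¬P = contradiction P[1+i] (Equivalence.to P⇔¬P P[N-i])
  ... | yes _      | no  _      | _     = refl
  ... | no  _      | yes _      | _     = refl
  ... | no ¬P[N-i] | no ¬P[1+i] | P⇔¬P = contradiction (Equivalence.from P⇔¬P ¬P[1+i]) ¬P[N-i]

  2c≡N : 2 * c ≡ N
  2c≡N = begin
    c + (c + 0)                                           ≡⟨ cong (c +_) (ℕ.+-identityʳ c) ⟩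
    c + c                                                 ≡⟨ cong (_+ c) (sumUpTo-reverse (χ ∘′ suc) N) ⟩
    sumUpTo (λ i → χ (suc (N ∸ suc i))) N + c             ≡⟨ cong (_+ c) (sumUpTo-cong N (λ i i<N → cong χ (ℕ.+-∸-assoc 1 i<N))) ⟨
    sumUpTo (λ i → χ (N ∸ i)) N + c                       ≡⟨ sumUpTo-+ (λ i → χ (N ∸ i)) (χ ∘′ suc) N ⟨
    sumUpTo (λ i → χ (N ∸ i) + χ (suc i)) N               ≡⟨ sumUpTo-cong N complementary ⟩
    sumUpTo (λ _ → 1) N                                   ≡⟨ sumUpTo-const 1 N ⟩
    N * 1                                                 ≡⟨ ℕ.*-identityʳ N ⟩
    N                                                     ∎

∸-suc-+ : ∀ {l q} → l < q → (q ∸ suc l) + q ≡ (q ∸ l) + (q ∸ 1)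
∸-suc-+ {l} {suc p} (s≤s l≤p) = trans (ℕ.+-suc (p ∸ l) p) (cong (_+ p) (sym (ℕ.+-∸-assoc 1 l≤p)))

module _ {q N : ℕ} (3q<N : 3 * q < N) where

  module _ {f : ℕ → ℕ} (complement : ∀ l → 1 ≤ l → l < q → f l + f (q ∸ l) ≡ N) where

    large-if-partner-small : ∀ l → 1 ≤ l → l < q → f (q ∸ l) ≤ q → 2 * q < f l
    large-if-partner-small l 1≤l l<q partner≤q = ℕ.≰⇒> λ fl≤2q → ℕ.<⇒≱ 3q<N (begin
      N                   ≡⟨ complement l 1≤l l<q ⟨
      f l + f (q ∸ l)     ≤⟨ ℕ.+-mono-≤ fl≤2q partner≤q ⟩
      2 * q + q           ≡⟨ ℕ.+-comm (2 * q) q ⟩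
      3 * q               ∎)
      where open ℕ.≤-Reasoning

    small-at-1-impossible : 1 < q → (∀ l → suc l < q → f (suc l) ≤ f l + f 1) →
      (∀ l → 1 ≤ l → l < q → f l ≤ q ⊎ f (q ∸ l) ≤ q) → ¬ (f 1 ≤ q)
    small-at-1-impossible 1<q step small-or-partner-small f1≤q = ℕ.<⇒≱ 3q<N (begin
      N                   ≡⟨ complement 1 ℕ.≤-refl 1<q ⟨
      f 1 + f (q ∸ 1)     ≤⟨ ℕ.+-mono-≤ f1≤q (small (q ∸ 1) (ℕ.m<n⇒0<n∸m 1<q) q∸1<q) ⟩
      q + q               ≤⟨ ℕ.m≤n+m (q + q) q ⟩
      q + (q + q)         ≡⟨ cong (λ x → q + (q + x)) (ℕ.+-identityʳ q) ⟨
      3 * q               ∎)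
      where
      open ℕ.≤-Reasoning
      q∸1<q : q ∸ 1 < q
      q∸1<q = ℕ.∸-monoʳ-< {q} {1} {0} ℕ.z<s (ℕ.<⇒≤ 1<q)
      small : ∀ l → 1 ≤ l → l < q → f l ≤ q
      small (suc zero)    _ _   = f1≤q
      small (suc (suc j)) _ l<q
        with small (suc j) (s≤s z≤n) (ℕ.<-trans (ℕ.n<1+n (suc j)) l<q)
           | small-or-partner-small (suc (suc j)) (s≤s z≤n) l<q
      ... | _        | inj₁ fl≤q      = fl≤q
      ... | f[1+j]≤q | inj₂ partner≤q =
        contradiction (large-if-partner-small (suc (suc j)) (s≤s z≤n) l<q partner≤q) (ℕ.≤⇒≯ (begin
          f (suc (suc j))       ≤⟨ step (suc j) l<q ⟩
          f (suc j) + f 1       ≤⟨ ℕ.+-mono-≤ f[1+j]≤q f1≤q ⟩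
          q + q                 ≡⟨ cong (q +_) (ℕ.+-identityʳ q) ⟨
          2 * q                 ∎))

  large-pair : ∀ {f : ℕ → ℕ} → 1 < q →
    (∀ a b → f (a + b) ≤ f a + f b) → (∀ l → f (l + q) ≡ f l) →
    (∀ l → 1 ≤ l → l < q → f l + f (q ∸ l) ≡ N) →
    ∃[ l ] (1 ≤ l × l < q × q < f l × q < f (q ∸ l))
  large-pair {f} 1<q subadditive periodic complement
    with ℕ.anyUpTo? (λ l → (1 ℕ.≤? l) ×-dec (q ℕ.<? f l) ×-dec (q ℕ.<? f (q ∸ l))) q
  ... | yes (l , l<q , 1≤l , large , partner-large) = l , 1≤l , l<q , large , partner-large
  ... | no no-large-pair = contradiction₂ (small-or-partner-small 1 ℕ.≤-refl 1<q)
    (small-at-1-impossible complement 1<q (λ l _ → f-step l) small-or-partner-small)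
    (small-at-1-impossible g-complement 1<q g-step g-small-or-partner-small)
    where
    f-step : ∀ l → f (suc l) ≤ f l + f 1
    f-step l = subst (λ x → f x ≤ f l + f 1) (ℕ.+-comm l 1) (subadditive l 1)

    small-or-partner-small : ∀ l → 1 ≤ l → l < q → f l ≤ q ⊎ f (q ∸ l) ≤ q
    small-or-partner-small l 1≤l l<q with q ℕ.<? f l | q ℕ.<? f (q ∸ l)
    ... | yes large | yes partner-large = contradiction (l , l<q , 1≤l , large , partner-large) no-large-pair
    ... | no  ¬large | _                = inj₁ (ℕ.≮⇒≥ ¬large)
    ... | yes _      | no ¬partner-large = inj₂ (ℕ.≮⇒≥ ¬partner-large)

    g : ℕ → ℕ
    g l = f (q ∸ l)

    g-complement : ∀ l → 1 ≤ l → l < q → g l + g (q ∸ l) ≡ N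
    g-complement l 1≤l l<q = begin
      f (q ∸ l) + f (q ∸ (q ∸ l))  ≡⟨ cong (λ x → f (q ∸ l) + f x) (ℕ.m∸[m∸n]≡n (ℕ.<⇒≤ l<q)) ⟩
      f (q ∸ l) + f l              ≡⟨ ℕ.+-comm _ (f l) ⟩
      f l + f (q ∸ l)              ≡⟨ complement l 1≤l l<q ⟩
      N                            ∎
      where open ≡-Reasoning

    g-small-or-partner-small : ∀ l → 1 ≤ l → l < q → g l ≤ q ⊎ g (q ∸ l) ≤ q
    g-small-or-partner-small l 1≤l l<q = subst (λ x → f (q ∸ l) ≤ q ⊎ f x ≤ q) (sym (ℕ.m∸[m∸n]≡n (ℕ.<⇒≤ l<q)))
      (Sum.swap (small-or-partner-small l 1≤l l<q))

    g-step : ∀ l → suc l < q → g (suc l) ≤ g l + g 1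
    g-step l 1+l<q = begin
      f (q ∸ suc l)                ≡⟨ periodic (q ∸ suc l) ⟨
      f (q ∸ suc l + q)            ≡⟨ cong f (∸-suc-+ (ℕ.<-trans (ℕ.n<1+n l) 1+l<q)) ⟩
      f ((q ∸ l) + (q ∸ 1))        ≤⟨ subadditive (q ∸ l) (q ∸ 1) ⟩
      f (q ∸ l) + f (q ∸ 1)        ∎
      where open ℕ.≤-Reasoning

exactly-one-≡ : ∀ {A : Set} {a b c d : A} → c ≢ d → (a ≡ c × b ≡ d) ⊎ (a ≡ d × b ≡ c) → (b ≡ c) ⇔ (¬ a ≡ c)
exactly-one-≡ c≢d (inj₁ (a≡c , b≡d)) = mk⇔ (λ b≡c _ → c≢d (trans (sym b≡c) b≡d)) (contradiction a≡c)
exactly-one-≡ c≢d (inj₂ (a≡d , b≡c)) = mk⇔ (λ _ a≡c → c≢d (trans (sym a≡c) a≡d)) (λ _ → b≡c)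

m≢2*m : ∀ m .{{_ : NonZero m}} → m ≢ 2 * m
m≢2*m m m≡2m = contradiction (ℕ.*-cancelʳ-≡ 1 2 m (trans (ℕ.*-identityˡ m) m≡2m)) λ ()

quotients-summing-to-3 : ∀ c d {q} → 0 < c * q → 0 < d * q → c + d ≡ 3 → (c ≡ 1 × d ≡ 2) ⊎ (c ≡ 2 × d ≡ 1)
quotients-summing-to-3 0                            _ ()  _  _
quotients-summing-to-3 1                            _ _   _  refl = inj₁ (refl , refl)
quotients-summing-to-3 2                            _ _   _  refl = inj₂ (refl , refl)
quotients-summing-to-3 3                            _ _   () refl
quotients-summing-to-3 (suc (suc (suc (suc _)))) _ _   _  ()

positive-multiples-summing-to-3* : ∀ {q a b} .{{_ : NonZero q}} → q ∣ a → q ∣ b → 0 < a → 0 < b →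
  a + b ≡ 3 * q → (a ≡ q × b ≡ 2 * q) ⊎ (a ≡ 2 * q × b ≡ q)
positive-multiples-summing-to-3* {q} (ℕ.divides-refl c) (ℕ.divides-refl d) 0<a 0<b a+b≡3q
  with quotients-summing-to-3 c d 0<a 0<b (ℕ.*-cancelʳ-≡ (c + d) 3 q (trans (ℕ.*-distribʳ-+ q c d) a+b≡3q))
... | inj₁ (refl , refl) = inj₁ (ℕ.*-identityˡ q , refl)
... | inj₂ (refl , refl) = inj₂ (refl , ℕ.*-identityˡ q)

open import Data.Integer.Base as ℤ using (ℤ; +_)
import Data.Integer.Properties as ℤₚ
open import Data.Integer.Tactic.RingSolver using (solve-∀)

*-sumUpTo-≡-mod : ∀ {q} z f g n → (∀ i → z ℤ.* + f i ≡ + g i [mod q ]) →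
  z ℤ.* + sumUpTo f n ≡ + sumUpTo g n [mod q ]
*-sumUpTo-≡-mod z f g zero    _     = ≡⇒≡-mod (ℤₚ.*-zeroʳ z)
*-sumUpTo-≡-mod {q} z f g (suc n) z*f≡g = begin
  z ℤ.* + (f 0 + sumUpTo (f ∘′ suc) n)                ≡⟨ cong (z ℤ.*_) (ℤₚ.pos-+ (f 0) _) ⟩
  z ℤ.* (+ f 0 ℤ.+ + sumUpTo (f ∘′ suc) n)            ≡⟨ ℤₚ.*-distribˡ-+ z (+ f 0) _ ⟩
  z ℤ.* + f 0 ℤ.+ z ℤ.* + sumUpTo (f ∘′ suc) n        ≈⟨ +-cong-≡-mod (z*f≡g 0) z*Σf≡Σg ⟩
  + g 0 ℤ.+ + sumUpTo (g ∘′ suc) n                    ≡⟨ ℤₚ.pos-+ (g 0) _ ⟨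
  + (g 0 + sumUpTo (g ∘′ suc) n)                      ∎
  where
  open ≡-mod-Reasoning
  z*Σf≡Σg : z ℤ.* + sumUpTo (f ∘′ suc) n ≡ + sumUpTo (g ∘′ suc) n [mod q ]
  z*Σf≡Σg = *-sumUpTo-≡-mod z (f ∘′ suc) (g ∘′ suc) n (λ i → z*f≡g (suc i))

module Orbit (q : ℕ) .{{_ : NonZero q}} (k : ℤ) where

  orbit : ℕ → ℕ → ℕ
  orbit l i = red q (k ^ℤ i ℤ.* + l)

  S≡sumUpTo-orbit : ∀ n l → S q k n l ≡ sumUpTo (orbit l) n
  S≡sumUpTo-orbit n l = cong sum (map-upTo (orbit l) n)

  private
    *-pos-+ : ∀ x a b → x ℤ.* + (a + b) ≡ x ℤ.* + a ℤ.+ x ℤ.* + b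
    *-pos-+ x a b = trans (cong (x ℤ.*_) (ℤₚ.pos-+ a b)) (ℤₚ.*-distribˡ-+ x (+ a) (+ b))

  orbit-subadditive : ∀ a b i → orbit (a + b) i ≤ orbit a i + orbit b i
  orbit-subadditive a b i = subst (_≤ orbit a i + orbit b i) (cong (red q) (sym (*-pos-+ (k ^ℤ i) a b)))
    (red-+-≤ q (k ^ℤ i ℤ.* + a) (k ^ℤ i ℤ.* + b))

  orbit-periodic : ∀ l i → orbit (l + q) i ≡ orbit l i
  orbit-periodic l i = red-cong q
    (≡-mod-trans (≡⇒≡-mod (*-pos-+ (k ^ℤ i) l q)) (+-multiple-≡-mod (k ^ℤ i ℤ.* + l) (k ^ℤ i)))

  orbit-step : ∀ l i → k ℤ.* + orbit l i ≡ + orbit l (suc i) [mod q ]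
  orbit-step l i = begin
    k ℤ.* + orbit l i                 ≈⟨ *-congˡ-≡-mod k (red-≡-mod q (k ^ℤ i ℤ.* + l)) ⟩
    k ℤ.* (k ^ℤ i ℤ.* + l)            ≡⟨ ℤₚ.*-assoc k (k ^ℤ i) (+ l) ⟨
    k ^ℤ suc i ℤ.* + l                ≈⟨ red-≡-mod q (k ^ℤ suc i ℤ.* + l) ⟨
    + orbit l (suc i)                 ∎
    where open ≡-mod-Reasoning

  S-subadditive : ∀ n a b → S q k n (a + b) ≤ S q k n a + S q k n b
  S-subadditive n a b = begin
    S q k n (a + b)                                     ≡⟨ S≡sumUpTo-orbit n (a + b) ⟩
    sumUpTo (orbit (a + b)) n                           ≤⟨ sumUpTo-mono-≤ n (orbit-subadditive a b) ⟩
    sumUpTo (λ i → orbit a i + orbit b i) n             ≡⟨ sumUpTo-+ (orbit a) (orbit b) n ⟩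
    sumUpTo (orbit a) n + sumUpTo (orbit b) n           ≡⟨ cong₂ _+_ (S≡sumUpTo-orbit n a) (S≡sumUpTo-orbit n b) ⟨
    S q k n a + S q k n b                               ∎
    where open ℕ.≤-Reasoning

  S-periodic : ∀ n l → S q k n (l + q) ≡ S q k n l
  S-periodic n l = begin
    S q k n (l + q)             ≡⟨ S≡sumUpTo-orbit n (l + q) ⟩
    sumUpTo (orbit (l + q)) n   ≡⟨ sumUpTo-cong n (λ i _ → orbit-periodic l i) ⟩
    sumUpTo (orbit l) n         ≡⟨ S≡sumUpTo-orbit n l ⟨
    S q k n l                   ∎
    where open ≡-Reasoning

  module _ (q-prime : Prime q) (k≢0 : ¬ (k ≡ + 0 [mod q ])) where

    orbit-≢0-mod : ∀ {l} i → 1 ≤ l → l < q → ¬ (k ^ℤ i ℤ.* + l ≡ + 0 [mod q ])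
    orbit-≢0-mod {l} i 1≤l l<q = [ prime-^-≢0-mod q-prime i k≢0 , l≢0 ]′ ∘′ prime-≡0-mod-* q-prime
      where
      l≢0 : ¬ (+ l ≡ + 0 [mod q ])
      l≢0 l≡0 = ℕ.<⇒≢ 1≤l (sym (residue-unique q l<q (ℕ.>-nonZero⁻¹ q) l≡0))

    orbit-positive : ∀ {l} i → 1 ≤ l → l < q → 0 < orbit l i
    orbit-positive i 1≤l l<q = ℕ.n≢0⇒n>0 (orbit-≢0-mod i 1≤l l<q ∘′ red≡0⇒≡0-mod q)

    orbit-complement : ∀ {l} i → 1 ≤ l → l < q → orbit l i + orbit (q ∸ l) i ≡ q
    orbit-complement {l} i 1≤l l<q = red-+-complement q sum≡0 (orbit-≢0-mod i 1≤l l<q)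
      where
      sum≡0 : k ^ℤ i ℤ.* + l ℤ.+ k ^ℤ i ℤ.* + (q ∸ l) ≡ + 0 [mod q ]
      sum≡0 = begin
        k ^ℤ i ℤ.* + l ℤ.+ k ^ℤ i ℤ.* + (q ∸ l)  ≡⟨ *-pos-+ (k ^ℤ i) l (q ∸ l) ⟨
        k ^ℤ i ℤ.* + (l + (q ∸ l))               ≡⟨ cong (λ x → k ^ℤ i ℤ.* + x) (ℕ.m+[n∸m]≡n (ℕ.<⇒≤ l<q)) ⟩
        k ^ℤ i ℤ.* + q                           ≈⟨ multiple-≡0-mod (k ^ℤ i) ⟩
        + 0                                      ∎
        where open ≡-mod-Reasoning

    S-positive : ∀ n {l} → 0 < n → 1 ≤ l → l < q → 0 < S q k n l
    S-positive (suc n) {l} _ 1≤l l<q = subst (0 <_) (sym (S≡sumUpTo-orbit (suc n) l))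
      (ℕ.<-≤-trans (orbit-positive 0 1≤l l<q) (ℕ.m≤m+n _ _))

    S-complement : ∀ n {l} → 1 ≤ l → l < q → S q k n l + S q k n (q ∸ l) ≡ n * q
    S-complement n {l} 1≤l l<q = begin
      S q k n l + S q k n (q ∸ l)                       ≡⟨ cong₂ _+_ (S≡sumUpTo-orbit n l) (S≡sumUpTo-orbit n (q ∸ l)) ⟩
      sumUpTo (orbit l) n + sumUpTo (orbit (q ∸ l)) n   ≡⟨ sumUpTo-+ (orbit l) (orbit (q ∸ l)) n ⟨
      sumUpTo (λ i → orbit l i + orbit (q ∸ l) i) n     ≡⟨ sumUpTo-cong n (λ i _ → orbit-complement i 1≤l l<q) ⟩
      sumUpTo (λ _ → q) n                               ≡⟨ sumUpTo-const q n ⟩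
      n * q                                             ∎
      where open ≡-Reasoning

  module OfOrder (q-prime : Prime q) {n : ℕ} (order : MultOrder q k n) where

    private
      0<n : 0 < n
      0<n = proj₁ order

    kⁿ≡1 : k ^ℤ n ≡ + 1 [mod q ]
    kⁿ≡1 = red-injective q (proj₁ (proj₂ order))

    k^m≢1 : ∀ {m} → 0 < m → m < n → ¬ (k ^ℤ m ≡ + 1 [mod q ])
    k^m≢1 0<m m<n = proj₂ (proj₂ order) _ 0<m m<n ∘′ red-cong q

    k≢0 : ¬ (k ≡ + 0 [mod q ])
    k≢0 k≡0 = prime-1≢0-mod q-prime (≡-mod-trans (≡-mod-sym kⁿ≡1) (kⁿ≡0 0<n))
      where
      kⁿ≡0 : ∀ {m} → 0 < m → k ^ℤ m ≡ + 0 [mod q ]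
      kⁿ≡0 {suc m} _ = ≡0-mod-^ m k≡0

    orbit-period : ∀ l → orbit l n ≡ orbit l 0
    orbit-period l = red-cong q (*-congʳ-≡-mod (+ l) kⁿ≡1)

    S-divisible : 1 < n → ∀ l → q ∣ S q k n l
    S-divisible 1<n l =
      subst (q ∣_) (sym (S≡sumUpTo-orbit n l)) (pos-≡0-mod⇒∣ (*-fixed⇒≡0-mod q-prime ks≡s k≢1))
      where
      s : ℕ
      s = sumUpTo (orbit l) n
      ks≡s : k ℤ.* + s ≡ + s [mod q ]
      ks≡s = ≡-mod-trans (*-sumUpTo-≡-mod k (orbit l) (orbit l ∘′ suc) n (orbit-step l))
                         (≡⇒≡-mod (cong +_ (sumUpTo-rotate (orbit l) n (orbit-period l))))
      k≢1 : ¬ (k ≡ + 1 [mod q ])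
      k≢1 = k^m≢1 ℕ.z<s 1<n ∘′ ≡-mod-trans (≡⇒≡-mod (ℤₚ.*-identityʳ k))

    module _ {m : ℕ} (n≡m+m : n ≡ m + m) where

      private
        0<m : 0 < m
        0<m = positive-half (subst (0 <_) n≡m+m 0<n)
          where
          positive-half : ∀ {j} → 0 < j + j → 0 < j
          positive-half {suc _} _ = ℕ.z<s

      kᵐ≡-1 : k ^ℤ m ℤ.+ + 1 ≡ + 0 [mod q ]
      kᵐ≡-1 = prime-square-root-of-1 q-prime
        (≡-mod-trans (≡⇒≡-mod (trans (sym (^ℤ-+ k m m)) (cong (k ^ℤ_) (sym n≡m+m)))) kⁿ≡1)
        (k^m≢1 0<m (subst (m <_) (sym n≡m+m) (ℕ.m<m+n m 0<m)))

      orbit-half-turn : ∀ {l} i → 1 ≤ l → l < q → orbit l i + orbit l (m + i) ≡ q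
      orbit-half-turn {l} i 1≤l l<q = red-+-complement q sum≡0 (orbit-≢0-mod q-prime k≢0 i 1≤l l<q)
        where
        identity : ∀ x y l → y ℤ.* l ℤ.+ x ℤ.* y ℤ.* l ≡ (x ℤ.+ + 1) ℤ.* (y ℤ.* l)
        identity = solve-∀
        sum≡0 : k ^ℤ i ℤ.* + l ℤ.+ k ^ℤ (m + i) ℤ.* + l ≡ + 0 [mod q ]
        sum≡0 = begin
          k ^ℤ i ℤ.* + l ℤ.+ k ^ℤ (m + i) ℤ.* + l           ≡⟨ cong (λ x → k ^ℤ i ℤ.* + l ℤ.+ x ℤ.* + l) (^ℤ-+ k m i) ⟩
          k ^ℤ i ℤ.* + l ℤ.+ k ^ℤ m ℤ.* k ^ℤ i ℤ.* + l      ≡⟨ identity (k ^ℤ m) (k ^ℤ i) (+ l) ⟩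
          (k ^ℤ m ℤ.+ + 1) ℤ.* (k ^ℤ i ℤ.* + l)              ≈⟨ *-congʳ-≡-mod (k ^ℤ i ℤ.* + l) kᵐ≡-1 ⟩
          + 0                                                 ∎
          where open ≡-mod-Reasoning

    S-even : 2 ∣ n → ∀ {l} → 1 ≤ l → l < q → S q k n l ≡ (n / 2) * q
    S-even (ℕ.divides m n≡m*2) {l} 1≤l l<q = begin
      S q k n l                                                  ≡⟨ S≡sumUpTo-orbit n l ⟩
      sumUpTo (orbit l) n                                        ≡⟨ cong (sumUpTo (orbit l)) n≡m+m ⟩
      sumUpTo (orbit l) (m + m)                                  ≡⟨ sumUpTo-+-split (orbit l) m m ⟩
      sumUpTo (orbit l) m + sumUpTo (λ i → orbit l (m + i)) m    ≡⟨ sumUpTo-+ (orbit l) (λ i → orbit l (m + i)) m ⟨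
      sumUpTo (λ i → orbit l i + orbit l (m + i)) m              ≡⟨ sumUpTo-cong m (λ i _ → orbit-half-turn {m} n≡m+m i 1≤l l<q) ⟩
      sumUpTo (λ _ → q) m                                        ≡⟨ sumUpTo-const q m ⟩
      m * q                                                      ≡⟨ trans (cong (λ x → x / 2 * q) n≡m*2) (cong (_* q) (m*n/n≡m m 2)) ⟨
      n / 2 * q                                                  ∎
      where
      open ≡-Reasoning
      n≡m+m : n ≡ m + m
      n≡m+m = trans n≡m*2 (trans (ℕ.*-comm m 2) (cong (_+_ m) (ℕ.+-identityʳ m)))

    module _ (n≡3 : n ≡ 3) {l : ℕ} (1≤l : 1 ≤ l) (l<q : l < q) where

      S-split-for-order-3 : (S q k n l ≡ q × S q k n (q ∸ l) ≡ 2 * q) ⊎ (S q k n l ≡ 2 * q × S q k n (q ∸ l) ≡ q)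
      S-split-for-order-3 = positive-multiples-summing-to-3*
        (S-divisible 1<n l) (S-divisible 1<n (q ∸ l))
        (S-positive q-prime k≢0 n 0<n 1≤l l<q) (S-positive q-prime k≢0 n 0<n (ℕ.m<n⇒0<n∸m l<q) q∸l<q)
        (trans (S-complement q-prime k≢0 n 1≤l l<q) (cong (_* q) n≡3))
        where
        1<n : 1 < n
        1<n = subst (1 <_) (sym n≡3) (s≤s (s≤s z≤n))
        q∸l<q : q ∸ l < q
        q∸l<q = ℕ.∸-monoʳ-< {q} {l} {0} 1≤l (ℕ.<⇒≤ l<q)

      S-swap-for-order-3 : (S q k n (q ∸ l) ≡ q) ⇔ (¬ S q k n l ≡ q)
      S-swap-for-order-3 = exactly-one-≡ (m≢2*m q) S-split-for-order-3

lemma4p4 : (q : ℕ) .{{_ : NonZero q}} → Prime q →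
    (n : ℕ) → 1 < n → n ∣ (q ∸ 1) →
    (k : ℤ) → MultOrder q k n →
    (∀ l → 1 ≤ l → l ≤ q ∸ 1 → q ∣ S q k n l)
    × (2 ∣ n → ∀ l → 1 ≤ l → l ≤ q ∸ 1 → S q k n l ≡ (n / 2) * q)
    × (n ≡ 3 →
        (∀ l → 1 ≤ l → l ≤ q ∸ 1 → (S q k n l ≡ q ⊎ S q k n l ≡ 2 * q))
        × length (filter (λ l → S q k n l ≟ q) (map suc (upTo (q ∸ 1)))) ≡ (q ∸ 1) / 2)
    × (¬ (2 ∣ n) → 3 < n →
        ∃[ l ] (1 ≤ l × l ≤ q ∸ 1 × S q k n l > q × S q k n (q ∸ l) > q))
lemma4p4 (suc p) q-prime n 1<n _ k order =
    (λ l _ _ → S-divisible 1<n l)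
  , (λ 2∣n l 1≤l l≤p → S-even 2∣n 1≤l (s≤s l≤p))
  , (λ n≡3 → (λ l 1≤l l≤p → Sum.map proj₁ proj₁ (S-split-for-order-3 n≡3 1≤l (s≤s l≤p)))
           , count-swapped-by-involution (λ l → S q k n l ≟ q) p
               (λ l 1≤l l≤p → S-swap-for-order-3 n≡3 1≤l (s≤s l≤p)))
  , (λ _ 3<n → let l , 1≤l , l<q , large = S-large-pair 3<n in l , 1≤l , ℕ.≤-pred l<q , large)
  where
  q : ℕ
  q = suc p
  open Orbit q k
  open OfOrder q-prime order
  1<q : 1 < q
  1<q = ℕ.nonTrivial⇒n>1 q {{prime⇒nonTrivial q-prime}}
  S-large-pair : 3 < n → ∃[ l ] (1 ≤ l × l < q × q < S q k n l × q < S q k n (q ∸ l))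
  S-large-pair 3<n = large-pair (ℕ.*-monoˡ-< q 3<n) 1<q (S-subadditive n) (S-periodic n)
    (λ _ → S-complement q-prime k≢0 n)
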